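{- Run the peel-off phase of Algorithm PMR (defined in the context) with parameter $\gamma\ge1$. Define $\epsilon$ by $OPT=(1-\epsilon)nW$. Fix $0<\delta<1/2$, an optimal full binary tree $T^*$, and the clusters $L,R'$ and the number $c$ defined in the context. Then $$W_{L,R'}\ \ge\ \frac{\delta W_B-(\epsilon+2c\delta\gamma)W}{\delta-c}.$$
   Context: Instance: a finite set $V$ of $n$ vertices of $G=(V,E)$ with nonnegative dissimilarity weights $w_{i,j}=w_{j,i}$; $W=\sum_{(i,j)\in E}w_{i,j}$. A hierarchical clustering tree is a rooted tree with leaf set $V$, each node representing the cluster of leaves below it; $Rev(T)=\sum_{i,j}w_{i,j}|T_{i,j}|$ where $|T_{i,j}|$ is the number of leaves of the subtree rooted at the least common ancestor of $i,j$; $OPT=\max_TRev(T)$, and $T^*$ is a full binary tree with $Rev(T^*)=OPT$. Peel-off phase: set $V_B\leftarrow V$, $E_B\leftarrow E$; while some $v\in V_B$ has $W_v=\sum_{u\in V_B,(v,u)\in E_B}w_{v,u}\ge\gamma\frac{2W}{n}$ (original $W,n$), choose $v^*$ with the largest $W_v$, delete it from $V_B$ and its incident edges from $E_B$. Afterwards $V_B$ are the blue vertices, $E_B$ the blue edges, of total weight $W_B$; the deleted (red) edges have total weight $W_R=W-W_B$. Layered structure: let $N$ be the deepest node of $T^*$ whose cluster has more than $n(1-\delta)$ vertices; let $L$ and $R'$ be the clusters of its two children, so $|L|,|R'|\le n(1-\delta)$ and $|L\cup R'|>n(1-\delta)$. Let $c=|V\setminus(L\cup R')|/n$, so $0\le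 c<\delta$. Let $V_{B\text{ - }Chain}=V_B\setminus(L\cup R')$, $W_{B\text{ - }Chain}$ the total weight of blue edges with an endpoint in $V_{B\text{ - }Chain}$, and $W_{L,R'}$ the total weight of blue edges with one endpoint in $L$ and the other in $R'$. (The paper calls the cluster $R'$ simply $R$.) -}

module Defs where

import Data.Nat

open import Data.Nat using (ℕ; zero; suc)
open import Data.Bool using (Bool; true; false; if_then_else_; _∧_; not)
open import Data.Fin using (Fin; toℕ)
open import Data.Fin.Properties using (_≟_)
open import Data.Integer using (+_)
open import Data.List using (List; []; _∷_; _++_; length)
import Data.List.Membership.DecPropositional as DecMem
open import Data.Rational using (ℚ; 0ℚ; _+_; _*_; _/_; _≤_; _<_)
open import Relation.Nullary using (does)
open import Relation.Binary.PropositionalEquality using (_≡_)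

ℕ→ℚ : ℕ → ℚ
ℕ→ℚ k = + k / 1

sumFin : {n : ℕ} → (Fin n → ℚ) → ℚ
sumFin {zero}  f = 0ℚ
sumFin {suc n} f = f Fin.zero + sumFin {n} (λ i → f (Fin.suc i))

sumPairs : {n : ℕ} → (Fin n → Fin n → ℚ) → ℚ
sumPairs f = sumFin (λ i → sumFin (λ j →
  if does (Data.Nat._<?_ (toℕ i) (toℕ j)) then f i j else 0ℚ))

-- Weighted graph on V = Fin n: w i j is the (nonnegative, symmetric)
-- dissimilarity of the pair {i,j}; non-edges have weight 0.
totalW : {n : ℕ} → (Fin n → Fin n → ℚ) → ℚ
totalW w = sumPairs w

data Tree (n : ℕ) : Set where
  leaf : Fin n → Tree n
  node : Tree n → Tree n → Tree n

leaves : {n : ℕ} → Tree n → List (Fin n)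
leaves (leaf v)   = v ∷ []
leaves (node l r) = leaves l ++ leaves r

size : {n : ℕ} → Tree n → ℕ
size t = length (leaves t)

inT : {n : ℕ} → Fin n → Tree n → Bool
inT {n} v t = does (DecMem._∈?_ (_≟_ {n}) v (leaves t))

lcaSize : {n : ℕ} → Tree n → Fin n → Fin n → ℕ
lcaSize (leaf v)   i j = 1
lcaSize (node l r) i j =
  if inT i l ∧ inT j l then lcaSize l i j
  else (if inT i r ∧ inT j r then lcaSize r i j else size (node l r))

Rev : {n : ℕ} → (Fin n → Fin n → ℚ) → Tree n → ℚ
Rev w t = sumPairs (λ i j → w i j * ℕ→ℚ (lcaSize t i j))

data SubTree {n : ℕ} : Tree n → Tree n → Set where
  here  : ∀ {t} → SubTree t t
  left  : ∀ {s l r} → SubTree s l → SubTree s (node l r)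
  right : ∀ {s l r} → SubTree s r → SubTree s (node l r)

Subset : ℕ → Set
Subset n = Fin n → Bool

remove : {n : ℕ} → Fin n → Subset n → Subset n
remove v S u = if does (u ≟ v) then false else S u

degIn : {n : ℕ} → (Fin n → Fin n → ℚ) → Subset n → Fin n → ℚ
degIn w S v = sumFin (λ u → if S u ∧ not (does (u ≟ v)) then w v u else 0ℚ)

weightIn : {n : ℕ} → (Fin n → Fin n → ℚ) → Subset n → ℚ
weightIn w S = sumPairs (λ i j → if S i ∧ S j then w i j else 0ℚ)

-- The threshold test  W_v ≥ γ·2W/n  is written
-- multiplied through by n > 0 :  γ·2·W ≤ W_v · n .
-- PeelOff w γ S VB : starting from current set S, some run of the loop
-- (ties broken arbitrarily) ends with blue set VB.
data PeelOff {n : ℕ} (w : Fin n → Fin n → ℚ) (γ : ℚ) : Subset n → Subset n → Set where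
  stop : ∀ {S} →
         (∀ v → S v ≡ true → degIn w S v * ℕ→ℚ n < γ * ℕ→ℚ 2 * totalW w) →
         PeelOff w γ S S
  step : ∀ {S VB} (v : Fin n) →
         S v ≡ true →
         γ * ℕ→ℚ 2 * totalW w ≤ degIn w S v * ℕ→ℚ n →
         (∀ u → S u ≡ true → degIn w S u ≤ degIn w S v) →
         PeelOff w γ (remove v S) VB →
         PeelOff w γ S VB

crossBlue : {n : ℕ} → (Fin n → Fin n → ℚ) → Subset n → Tree n → Tree n → ℚ
crossBlue w VB L R = sumFin (λ i → sumFin (λ j →
  if inT i L ∧ inT j R ∧ VB i ∧ VB j then w i j else 0ℚ))

module Submission where

-- Compare, pair by pair, the contribution w_ij |T*_ij| of {i,j} to Rev(T*) with n w_ij.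
-- A blue pair inside L or inside R' has |T*_ij| ≤ n(1 − δ), a slack of nδ w_ij; a blue pair
-- across L and R' has |T*_ij| = |N| = n(1 − c), so the same slack overshoots by n(δ − c) w_ij;
-- a blue pair with an endpoint outside N is charged to that endpoint, whose blue degree is
-- below the peel-off threshold 2γW/n, and there are at most cn such endpoints. Summing,
--   nδ W_B + Rev(T*) ≤ n(δ − c) W_{L,R'} + nW + nδ · cn · 2γW/n,
-- which together with Rev(T*) = (1 − ε) nW is the claim multiplied by n.

open import Defs
open import Algebra.Bundles using (CommutativeRing)
open import Data.Bool using (Bool; true; false; if_then_else_; _∧_; _∨_; not)
open import Data.Bool.Properties using (∧-zeroʳ; ∨-zeroʳ)
open import Data.Fin using (Fin; toℕ)
import Data.Fin as Fin
open import Data.Fin.Properties using (_≟_)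
import Data.Integer as ℤ
import Data.Integer.Properties as ℤ
open import Data.List using (List; []; _∷_; _++_; length; foldr; map; tabulate; allFin)
open import Data.List.Properties using (length-++; length-tabulate)
import Data.List.Membership.DecPropositional as DecMem
open import Data.List.Membership.Propositional using (_∈_; _∉_)
open import Data.List.Membership.Propositional.Properties using (∈-++⁺ˡ; ∈-++⁺ʳ; ∈-++⁻)
open import Data.List.Relation.Binary.Permutation.Propositional using (_↭_; ↭-sym; ↭⇒↭ₛ)
open import Data.List.Relation.Binary.Permutation.Propositional.Properties using (map⁺; ↭-length)
open import Data.List.Relation.Binary.Permutation.Setoid.Properties using (foldr-commMonoid; Unique-resp-↭)
open import Data.List.Relation.Unary.All using (lookup)
open import Data.List.Relation.Unary.All.Properties using (++⁻ˡ)
open import Data.List.Relation.Unary.AllPairs using ([]; _∷_)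
open import Data.List.Relation.Unary.Any using (here; there)
open import Data.List.Relation.Unary.Unique.Propositional using (Unique)
open import Data.List.Relation.Unary.Unique.Propositional.Properties using (allFin⁺)
open import Data.Nat as ℕ using (ℕ; zero; suc; _∸_)
import Data.Nat.Properties as ℕ
open import Data.Rational using (ℚ; 0ℚ; 1ℚ; _+_; _*_; _-_; -_; _≤_; _<_; toℚᵘ; nonNegative; positive)
open import Data.Rational.Properties hiding (_≟_)
open import Data.Rational.Solver using (module +-*-Solver)
import Data.Rational.Unnormalised as ℚᵘ
import Data.Rational.Unnormalised.Properties as ℚᵘ
open import Data.Sum using (inj₁; inj₂)
open import Function using (_∘_)
open import Relation.Binary.PropositionalEquality
open import Relation.Nullary using (does; yes; no; contradiction)
open import Relation.Nullary.Decidable using (dec-true; dec-false)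

open import Algebra.Properties.Semiring.Sum (CommutativeRing.semiring +-*-commutativeRing)
  using (sum; sum-cong-≗; sum-replicate-zero; ∑-distrib-+; ∑-comm; *-distribˡ-sum)
open +-*-Solver using (solve; _:+_; _:*_; _:-_; _:=_; con)

-- Rationals

ℕ→ℚ-+ : ∀ a b → ℕ→ℚ (a ℕ.+ b) ≡ ℕ→ℚ a + ℕ→ℚ b
ℕ→ℚ-+ a b = toℚᵘ-injective (begin
  toℚᵘ (ℕ→ℚ (a ℕ.+ b))             ≈⟨ toℚᵘ-fromℚᵘ (ℕ→ℚᵘ (a ℕ.+ b)) ⟩
  ℕ→ℚᵘ (a ℕ.+ b)                   ≈⟨ ℚᵘ.*≡* cross-multiplied ⟩
  ℕ→ℚᵘ a ℚᵘ.+ ℕ→ℚᵘ b               ≈⟨ ℚᵘ.+-cong (toℚᵘ-fromℚᵘ (ℕ→ℚᵘ a)) (toℚᵘ-fromℚᵘ (ℕ→ℚᵘ b)) ⟨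
  toℚᵘ (ℕ→ℚ a) ℚᵘ.+ toℚᵘ (ℕ→ℚ b)  ≈⟨ toℚᵘ-homo-+ (ℕ→ℚ a) (ℕ→ℚ b) ⟨
  toℚᵘ (ℕ→ℚ a + ℕ→ℚ b)             ∎)
  where
  open import Relation.Binary.Reasoning.Setoid ℚᵘ.≃-setoid
  ℕ→ℚᵘ : ℕ → ℚᵘ.ℚᵘ
  ℕ→ℚᵘ k = ℚᵘ.mkℚᵘ (ℤ.+ k) 0
  cross-multiplied : ℤ.+ (a ℕ.+ b) ℤ.* ℤ.+ 1 ≡ (ℤ.+ a ℤ.* ℤ.+ 1 ℤ.+ ℤ.+ b ℤ.* ℤ.+ 1) ℤ.* ℤ.+ 1
  cross-multiplied rewrite ℤ.*-identityʳ (ℤ.+ a) | ℤ.*-identityʳ (ℤ.+ b) | ℤ.*-identityʳ (ℤ.+ a ℤ.+ ℤ.+ b)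
    = ℤ.pos-+ a b

0≤ℕ→ℚ : ∀ k → 0ℚ ≤ ℕ→ℚ k
0≤ℕ→ℚ k = nonNegative⁻¹ (ℕ→ℚ k) {{normalize-nonNeg k 1}}

p≤p+q : ∀ p {q} → 0ℚ ≤ q → p ≤ p + q
p≤p+q p 0≤q = subst (_≤ p + _) (+-identityʳ p) (+-monoʳ-≤ p 0≤q)

ℕ→ℚ-mono-≤ : ∀ {a b} → a ℕ.≤ b → ℕ→ℚ a ≤ ℕ→ℚ b
ℕ→ℚ-mono-≤ {a} {b} a≤b = subst (ℕ→ℚ a ≤_) eq (p≤p+q (ℕ→ℚ a) (0≤ℕ→ℚ (b ∸ a)))
  where
  eq : ℕ→ℚ a + ℕ→ℚ (b ∸ a) ≡ ℕ→ℚ b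
  eq = trans (sym (ℕ→ℚ-+ a (b ∸ a))) (cong ℕ→ℚ (ℕ.m+[n∸m]≡n a≤b))

ℕ→ℚ-∸ : ∀ {m n} → m ℕ.≤ n → ℕ→ℚ (n ∸ m) + ℕ→ℚ m ≡ ℕ→ℚ n
ℕ→ℚ-∸ {m} {n} m≤n = trans (sym (ℕ→ℚ-+ (n ∸ m) m)) (cong ℕ→ℚ (ℕ.m∸n+n≡m m≤n))

+-nonNeg : ∀ {p q} → 0ℚ ≤ p → 0ℚ ≤ q → 0ℚ ≤ p + q
+-nonNeg {p} 0≤p 0≤q = ≤-trans 0≤p (p≤p+q p 0≤q)

*-monoˡ-≤-0≤ : ∀ {r p q} → 0ℚ ≤ r → p ≤ q → r * p ≤ r * q
*-monoˡ-≤-0≤ {r} 0≤r = *-monoˡ-≤-nonNeg r {{nonNegative 0≤r}}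

*-nonNeg : ∀ {p q} → 0ℚ ≤ p → 0ℚ ≤ q → 0ℚ ≤ p * q
*-nonNeg {p} 0≤p 0≤q = subst (_≤ p * _) (*-zeroʳ p) (*-monoˡ-≤-0≤ 0≤p 0≤q)

0≤q-p : ∀ {p q} → p ≤ q → 0ℚ ≤ q - p
0≤q-p {p} {q} p≤q = subst (_≤ q - p) (+-inverseʳ p) (+-monoˡ-≤ (- p) p≤q)

+-cancelʳ-≤ : ∀ r {p q} → p + r ≤ q + r → p ≤ q
+-cancelʳ-≤ r {p} {q} p+r≤q+r = subst₂ _≤_ (cancel p) (cancel q) (+-monoˡ-≤ (- r) p+r≤q+r)
  where
  cancel : ∀ x → x + r - r ≡ x
  cancel x = solve 2 (λ x r → x :+ r :- r := x) refl x r

-- Finite sums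

sumFin≡sum : ∀ {n} (f : Fin n → ℚ) → sumFin f ≡ sum f
sumFin≡sum {zero}  f = refl
sumFin≡sum {suc n} f = cong (f Fin.zero +_) (sumFin≡sum (λ i → f (Fin.suc i)))

sumFin²≡sum² : ∀ {m n} (f : Fin m → Fin n → ℚ) →
  sumFin (λ i → sumFin (f i)) ≡ sum (λ i → sum (f i))
sumFin²≡sum² {m} f = trans (sumFin≡sum {m} _) (sum-cong-≗ (λ i → sumFin≡sum (f i)))

sumFin-cong : ∀ {n} {f g : Fin n → ℚ} → (∀ i → f i ≡ g i) → sumFin f ≡ sumFin g
sumFin-cong {f = f} {g} f≗g rewrite sumFin≡sum f | sumFin≡sum g = sum-cong-≗ f≗g

sumFin-+ : ∀ {n} (f g : Fin n → ℚ) → sumFin (λ i → f i + g i) ≡ sumFin f + sumFin g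
sumFin-+ f g rewrite sumFin≡sum f | sumFin≡sum g | sumFin≡sum (λ i → f i + g i) = ∑-distrib-+ f g

sumFin-*ˡ : ∀ {n} k (f : Fin n → ℚ) → sumFin (λ i → k * f i) ≡ k * sumFin f
sumFin-*ˡ k f rewrite sumFin≡sum f | sumFin≡sum (λ i → k * f i) = sym (*-distribˡ-sum k f)

sumFin-zero : ∀ n → sumFin {n} (λ _ → 0ℚ) ≡ 0ℚ
sumFin-zero n = trans (sumFin≡sum {n} _) (sum-replicate-zero n)

sumFin-comm : ∀ {m n} (f : Fin m → Fin n → ℚ) →
  sumFin (λ i → sumFin (f i)) ≡ sumFin (λ j → sumFin (λ i → f i j))
sumFin-comm f = trans (sumFin²≡sum² f) (trans (∑-comm f) (sym (sumFin²≡sum² (λ j i → f i j))))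

sumFin-mono-≤ : ∀ {n} {f g : Fin n → ℚ} → (∀ i → f i ≤ g i) → sumFin f ≤ sumFin g
sumFin-mono-≤ {zero}  f≤g = ≤-refl
sumFin-mono-≤ {suc n} f≤g = +-mono-≤ (f≤g Fin.zero) (sumFin-mono-≤ (λ i → f≤g (Fin.suc i)))

sumFin-nonNeg : ∀ {n} {f : Fin n → ℚ} → (∀ i → 0ℚ ≤ f i) → 0ℚ ≤ sumFin f
sumFin-nonNeg {n} {f} 0≤f = subst (_≤ sumFin f) (sumFin-zero n) (sumFin-mono-≤ 0≤f)

sumFin-if : ∀ {n} b (f : Fin n → ℚ) →
  sumFin (λ i → if b then f i else 0ℚ) ≡ (if b then sumFin f else 0ℚ)
sumFin-if true  f = refl
sumFin-if {n} false f = sumFin-zero n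

if-+ : ∀ b x y → (if b then x + y else 0ℚ) ≡ (if b then x else 0ℚ) + (if b then y else 0ℚ)
if-+ true  x y = refl
if-+ false x y = sym (+-identityʳ 0ℚ)

if-*ˡ : ∀ b k x → (if b then k * x else 0ℚ) ≡ k * (if b then x else 0ℚ)
if-*ˡ true  k x = refl
if-*ˡ false k x = sym (*-zeroʳ k)

if-true : ∀ {b} x → b ≡ true → (if b then x else 0ℚ) ≡ x
if-true x refl = refl

∧-true : ∀ {a b} → a ≡ true → b ≡ true → a ∧ b ≡ true
∧-true refl refl = refl

if-nonNeg : ∀ b {x} → 0ℚ ≤ x → 0ℚ ≤ (if b then x else 0ℚ)
if-nonNeg true  0≤x = 0≤x
if-nonNeg false 0≤x = ≤-refl

sumPairs-+ : ∀ {n} (f g : Fin n → Fin n → ℚ) →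
  sumPairs (λ i j → f i j + g i j) ≡ sumPairs f + sumPairs g
sumPairs-+ {n} f g = trans
  (sumFin-cong (λ i → trans (sumFin-cong (λ j → if-+ _ (f i j) (g i j))) (sumFin-+ {n} _ _)))
  (sumFin-+ {n} _ _)

sumPairs-*ˡ : ∀ {n} k (f : Fin n → Fin n → ℚ) → sumPairs (λ i j → k * f i j) ≡ k * sumPairs f
sumPairs-*ˡ {n} k f = trans
  (sumFin-cong (λ i → trans (sumFin-cong (λ j → if-*ˡ _ k (f i j))) (sumFin-*ˡ {n} k _)))
  (sumFin-*ˡ {n} k _)

sumPairs-mono-≤ : ∀ {n} {f g : Fin n → Fin n → ℚ} →
  (∀ i j → toℕ i ℕ.< toℕ j → f i j ≤ g i j) → sumPairs f ≤ sumPairs g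
sumPairs-mono-≤ {f = f} {g} f≤g = sumFin-mono-≤ (λ i → sumFin-mono-≤ (λ j → below i j))
  where
  below : ∀ i j → (if does (toℕ i ℕ.<? toℕ j) then f i j else 0ℚ)
                ≤ (if does (toℕ i ℕ.<? toℕ j) then g i j else 0ℚ)
  below i j with toℕ i ℕ.<ᵇ toℕ j | ℕ.<ᵇ⇒< (toℕ i) (toℕ j)
  ... | true  | i<j = f≤g i j (i<j _)
  ... | false | _   = ≤-refl

sumPairs-sym-≤ : ∀ {n} (f : Fin n → Fin n → ℚ) → (∀ i j → 0ℚ ≤ f i j) →
  sumPairs (λ i j → f i j + f j i) ≤ sumFin (λ i → sumFin (f i))
sumPairs-sym-≤ {n} f 0≤f = begin
  sumPairs (λ i j → f i j + f j i)
    ≡⟨ sumPairs-+ f (λ i j → f j i) ⟩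
  sumPairs f + sumFin (λ i → sumFin (λ j → ifLess i j (f j i)))
    ≡⟨ cong (sumPairs f +_) (sumFin-comm (λ i j → ifLess i j (f j i))) ⟩
  sumPairs f + sumFin (λ i → sumFin (λ j → ifLess j i (f i j)))
    ≡⟨ sym (sumFin-+ {n} _ _) ⟩
  sumFin (λ i → sumFin (λ j → ifLess i j (f i j)) + sumFin (λ j → ifLess j i (f i j)))
    ≡⟨ sumFin-cong {n} (λ i → sym (sumFin-+ {n} _ _)) ⟩
  sumFin (λ i → sumFin (λ j → ifLess i j (f i j) + ifLess j i (f i j)))
    ≤⟨ sumFin-mono-≤ (λ i → sumFin-mono-≤ (λ j → at-most-one-order i j)) ⟩
  sumFin (λ i → sumFin (f i)) ∎
  where
  open ≤-Reasoning
  ifLess : Fin n → Fin n → ℚ → ℚ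
  ifLess i j x = if does (toℕ i ℕ.<? toℕ j) then x else 0ℚ
  at-most-one-order : ∀ i j → ifLess i j (f i j) + ifLess j i (f i j) ≤ f i j
  at-most-one-order i j with toℕ i ℕ.<ᵇ toℕ j | ℕ.<ᵇ⇒< (toℕ i) (toℕ j)
                  | toℕ j ℕ.<ᵇ toℕ i | ℕ.<ᵇ⇒< (toℕ j) (toℕ i)
  ... | true  | i<j | true  | j<i = contradiction (j<i _) (ℕ.<-asym (i<j _))
  ... | true  | _   | false | _   = ≤-reflexive (+-identityʳ (f i j))
  ... | false | _   | true  | _   = ≤-reflexive (+-identityˡ (f i j))
  ... | false | _   | false | _   = subst (_≤ f i j) (sym (+-identityʳ 0ℚ)) (0≤f i j)

-- Lists and trees

listSum : ∀ {A : Set} → (A → ℚ) → List A → ℚ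
listSum g xs = foldr _+_ 0ℚ (map g xs)

listSum-tabulate : ∀ {A : Set} {n} (g : A → ℚ) (f : Fin n → A) →
  listSum g (tabulate f) ≡ sumFin (λ i → g (f i))
listSum-tabulate {n = zero}  g f = refl
listSum-tabulate {n = suc n} g f = cong (g (f Fin.zero) +_) (listSum-tabulate g (λ i → f (Fin.suc i)))

listSum-↭ : ∀ {A : Set} (g : A → ℚ) {xs ys} → xs ↭ ys → listSum g xs ≡ listSum g ys
listSum-↭ g p = foldr-commMonoid (setoid ℚ) +-0-isCommutativeMonoid (↭⇒↭ₛ (map⁺ g p))

listSum-++ : ∀ {A : Set} (g : A → ℚ) xs ys → listSum g (xs ++ ys) ≡ listSum g xs + listSum g ys
listSum-++ g []       ys = sym (+-identityˡ _)
listSum-++ g (x ∷ xs) ys = trans (cong (g x +_) (listSum-++ g xs ys)) (sym (+-assoc (g x) _ _))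

listSum-≤-length : ∀ {A : Set} {g : A → ℚ} → (∀ x → g x ≤ 1ℚ) → ∀ xs → listSum g xs ≤ ℕ→ℚ (length xs)
listSum-≤-length g≤1 []       = ≤-refl
listSum-≤-length {g = g} g≤1 (x ∷ xs) =
  subst (listSum g (x ∷ xs) ≤_) (sym (ℕ→ℚ-+ 1 (length xs))) (+-mono-≤ (g≤1 x) (listSum-≤-length g≤1 xs))

listSum-zero : ∀ {A : Set} {g : A → ℚ} xs → (∀ {x} → x ∈ xs → g x ≡ 0ℚ) → listSum g xs ≡ 0ℚ
listSum-zero []       g≡0 = refl
listSum-zero (x ∷ xs) g≡0 =
  trans (cong₂ _+_ (g≡0 (here refl)) (listSum-zero xs (g≡0 ∘ there))) (+-identityʳ 0ℚ)

Unique-++⁻ˡ : ∀ {A : Set} (xs : List A) {ys} → Unique (xs ++ ys) → Unique xs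
Unique-++⁻ˡ []       u           = []
Unique-++⁻ˡ (x ∷ xs) (x∉ ∷ u)    = ++⁻ˡ xs x∉ ∷ Unique-++⁻ˡ xs u

Unique-++⁻ʳ : ∀ {A : Set} (xs : List A) {ys} → Unique (xs ++ ys) → Unique ys
Unique-++⁻ʳ []       u        = u
Unique-++⁻ʳ (x ∷ xs) (_ ∷ u)  = Unique-++⁻ʳ xs u

Unique-++⇒∉ : ∀ {A : Set} (xs : List A) {ys v} → Unique (xs ++ ys) → v ∈ xs → v ∉ ys
Unique-++⇒∉ (x ∷ xs) (x≢ ∷ u) (here refl) v∈ys = lookup x≢ (∈-++⁺ʳ xs v∈ys) refl
Unique-++⇒∉ (x ∷ xs) (_  ∷ u) (there v∈xs) = Unique-++⇒∉ xs u v∈xs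

size-node : ∀ {n} (l r : Tree n) → ℕ→ℚ (size (node l r)) ≡ ℕ→ℚ (size l) + ℕ→ℚ (size r)
size-node l r = trans (cong ℕ→ℚ (length-++ (leaves l))) (ℕ→ℚ-+ (size l) (size r))

SubTree-∈ : ∀ {n} {s t : Tree n} {x} → SubTree s t → x ∈ leaves s → x ∈ leaves t
SubTree-∈ here                   x∈s = x∈s
SubTree-∈ (left p)               x∈s = ∈-++⁺ˡ (SubTree-∈ p x∈s)
SubTree-∈ (right {l = l} p)      x∈s = ∈-++⁺ʳ (leaves l) (SubTree-∈ p x∈s)

SubTree-Unique : ∀ {n} {s t : Tree n} → SubTree s t → Unique (leaves t) → Unique (leaves s)
SubTree-Unique here              u = u
SubTree-Unique (left {l = l} p)  u = SubTree-Unique p (Unique-++⁻ˡ (leaves l) u)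
SubTree-Unique (right {l = l} p) u = SubTree-Unique p (Unique-++⁻ʳ (leaves l) u)

SubTree-size-≤ : ∀ {n} {s t : Tree n} → SubTree s t → size s ℕ.≤ size t
SubTree-size-≤ here              = ℕ.≤-refl
SubTree-size-≤ (left {l = l} p)  =
  ℕ.≤-trans (SubTree-size-≤ p) (subst (size l ℕ.≤_) (sym (length-++ (leaves l))) (ℕ.m≤m+n _ _))
SubTree-size-≤ (right {l = l} p) =
  ℕ.≤-trans (SubTree-size-≤ p) (subst (_ ℕ.≤_) (sym (length-++ (leaves l))) (ℕ.m≤n+m _ _))

SubTree-trans : ∀ {n} {s t u : Tree n} → SubTree s t → SubTree t u → SubTree s u
SubTree-trans s≤t here      = s≤t
SubTree-trans s≤t (left p)  = left (SubTree-trans s≤t p)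
SubTree-trans s≤t (right p) = right (SubTree-trans s≤t p)

inT-∈ : ∀ {n} {x : Fin n} t → x ∈ leaves t → inT x t ≡ true
inT-∈ {n} {x} t = dec-true (DecMem._∈?_ (_≟_ {n}) x (leaves t))

inT-∉ : ∀ {n} {x : Fin n} t → x ∉ leaves t → inT x t ≡ false
inT-∉ {n} {x} t = dec-false (DecMem._∈?_ (_≟_ {n}) x (leaves t))

lcaSize-≤-size : ∀ {n} (t : Tree n) i j → lcaSize t i j ℕ.≤ size t
lcaSize-≤-size (leaf v)   i j = ℕ.≤-refl
lcaSize-≤-size (node l r) i j with inT i l ∧ inT j l
... | true  = ℕ.≤-trans (lcaSize-≤-size l i j) (SubTree-size-≤ {t = node l r} (left here))
... | false with inT i r ∧ inT j r
...   | true  = ℕ.≤-trans (lcaSize-≤-size r i j) (SubTree-size-≤ {t = node l r} (right here))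
...   | false = ℕ.≤-refl

lcaSize-SubTree : ∀ {n} {s t : Tree n} {x y} → SubTree s t → Unique (leaves t) →
  x ∈ leaves s → y ∈ leaves s → lcaSize t x y ≡ lcaSize s x y
lcaSize-SubTree here u x∈s y∈s = refl
lcaSize-SubTree (left {l = l} p) u x∈s y∈s
  rewrite inT-∈ l (SubTree-∈ p x∈s) | inT-∈ l (SubTree-∈ p y∈s)
  = lcaSize-SubTree p (Unique-++⁻ˡ (leaves l) u) x∈s y∈s
lcaSize-SubTree (right {l = l} {r} p) u x∈s y∈s
  rewrite inT-∉ l (λ x∈l → Unique-++⇒∉ (leaves l) u x∈l (SubTree-∈ p x∈s))
        | inT-∈ r (SubTree-∈ p x∈s) | inT-∈ r (SubTree-∈ p y∈s)
  = lcaSize-SubTree p (Unique-++⁻ʳ (leaves l) u) x∈s y∈s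

lcaSize-split : ∀ {n} {l r : Tree n} {x y} → Unique (leaves (node l r)) →
  x ∈ leaves l → y ∈ leaves r → lcaSize (node l r) x y ≡ size (node l r)
lcaSize-split {l = l} {r} {x} {y} u x∈l y∈r
  rewrite inT-∉ l (λ y∈l → Unique-++⇒∉ (leaves l) u y∈l y∈r)
        | inT-∉ r (Unique-++⇒∉ (leaves l) u x∈l)
        | ∧-zeroʳ (inT x l)
  = refl

lcaSize-split′ : ∀ {n} {l r : Tree n} {x y} → Unique (leaves (node l r)) →
  x ∈ leaves r → y ∈ leaves l → lcaSize (node l r) x y ≡ size (node l r)
lcaSize-split′ {l = l} {r} {x} {y} u x∈r y∈l
  rewrite inT-∉ l (λ x∈l → Unique-++⇒∉ (leaves l) u x∈l x∈r)
        | inT-∉ r (Unique-++⇒∉ (leaves l) u y∈l)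
        | ∧-zeroʳ (inT x r)
  = refl

listSum-SubTree : ∀ {n} {g : Fin n → ℚ} → (∀ x → g x ≤ 1ℚ) → ∀ {s t} → SubTree s t →
  listSum g (leaves t) + ℕ→ℚ (size s) ≤ listSum g (leaves s) + ℕ→ℚ (size t)
listSum-SubTree {n} {g} g≤1 {s} = go
  where
  open ≤-Reasoning
  σ ♯ : Tree n → ℚ
  σ t = listSum g (leaves t)
  ♯ t = ℕ→ℚ (size t)
  σ-node : ∀ l r → σ (node l r) ≡ σ l + σ r
  σ-node l r = listSum-++ g (leaves l) (leaves r)
  go : ∀ {t} → SubTree s t → σ t + ♯ s ≤ σ s + ♯ t
  go here = ≤-refl
  go (left {l = l} {r} p) = begin
    σ (node l r) + ♯ s  ≡⟨ cong (_+ ♯ s) (σ-node l r) ⟩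
    σ l + σ r + ♯ s     ≡⟨ solve 3 (λ a b c → a :+ b :+ c := a :+ c :+ b) refl (σ l) (σ r) (♯ s) ⟩
    σ l + ♯ s + σ r     ≤⟨ +-mono-≤ (go p) (listSum-≤-length g≤1 (leaves r)) ⟩
    σ s + ♯ l + ♯ r     ≡⟨ +-assoc (σ s) (♯ l) (♯ r) ⟩
    σ s + (♯ l + ♯ r)   ≡⟨ cong (σ s +_) (size-node l r) ⟨
    σ s + ♯ (node l r)  ∎
  go (right {l = l} {r} p) = begin
    σ (node l r) + ♯ s  ≡⟨ cong (_+ ♯ s) (σ-node l r) ⟩
    σ l + σ r + ♯ s     ≡⟨ +-assoc (σ l) (σ r) (♯ s) ⟩
    σ l + (σ r + ♯ s)   ≤⟨ +-mono-≤ (listSum-≤-length g≤1 (leaves l)) (go p) ⟩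
    ♯ l + (σ s + ♯ r)   ≡⟨ solve 3 (λ a b c → a :+ (b :+ c) := b :+ (a :+ c)) refl (♯ l) (σ s) (♯ r) ⟩
    σ s + (♯ l + ♯ r)   ≡⟨ cong (σ s +_) (size-node l r) ⟨
    σ s + ♯ (node l r)  ∎

-- The estimate

PeelOff⇒degIn<threshold : ∀ {n} {w : Fin n → Fin n → ℚ} {γ S VB} → PeelOff w γ S VB →
  ∀ v → VB v ≡ true → degIn w VB v * ℕ→ℚ n < γ * ℕ→ℚ 2 * totalW w
PeelOff⇒degIn<threshold (stop low)           = low
PeelOff⇒degIn<threshold (step _ _ _ _ peel)  = PeelOff⇒degIn<threshold peel

-- One pair's share of the estimate: a = nδ, b = n(δ − c), ℓ = |T*_ij|, X is the blue weight
-- of the pair across L and R', and Y the blue weight charged to its endpoints outside N.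
module PairBound (a b n X Y w ℓ : ℚ)
  (0≤w : 0ℚ ≤ w) (ℓ≤n : ℓ ≤ n) (0≤bX : 0ℚ ≤ b * X) (0≤aY : 0ℚ ≤ a * Y) where
  private
    wℓ≤nw : w * ℓ ≤ n * w
    wℓ≤nw = subst (w * ℓ ≤_) (*-comm w n) (*-monoˡ-≤-0≤ 0≤w ℓ≤n)

    nw≤bX+nw : n * w ≤ b * X + n * w
    nw≤bX+nw = subst (n * w ≤_) (+-comm (n * w) (b * X)) (p≤p+q (n * w) 0≤bX)

    bX+nw≤rhs : b * X + n * w ≤ b * X + n * w + a * Y
    bX+nw≤rhs = p≤p+q (b * X + n * w) 0≤aY

  pair-bound-unblue : a * 0ℚ + w * ℓ ≤ b * X + n * w + a * Y
  pair-bound-unblue = begin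
    a * 0ℚ + w * ℓ      ≡⟨ trans (cong (_+ w * ℓ) (*-zeroʳ a)) (+-identityˡ (w * ℓ)) ⟩
    w * ℓ               ≤⟨ wℓ≤nw ⟩
    n * w               ≤⟨ nw≤bX+nw ⟩
    b * X + n * w       ≤⟨ bX+nw≤rhs ⟩
    b * X + n * w + a * Y ∎
    where open ≤-Reasoning

  pair-bound-nested : ℓ + a ≤ n → a * w + w * ℓ ≤ b * X + n * w + a * Y
  pair-bound-nested ℓ+a≤n = begin
    a * w + w * ℓ       ≡⟨ solve 3 (λ a w ℓ → a :* w :+ w :* ℓ := w :* (ℓ :+ a)) refl a w ℓ ⟩
    w * (ℓ + a)         ≤⟨ *-monoˡ-≤-0≤ 0≤w ℓ+a≤n ⟩
    w * n               ≡⟨ *-comm w n ⟩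
    n * w               ≤⟨ nw≤bX+nw ⟩
    b * X + n * w       ≤⟨ bX+nw≤rhs ⟩
    b * X + n * w + a * Y ∎
    where open ≤-Reasoning

  pair-bound-split : 0ℚ ≤ b → ℓ + a ≡ n + b → w ≤ X → a * w + w * ℓ ≤ b * X + n * w + a * Y
  pair-bound-split 0≤b ℓ+a≡n+b w≤X = begin
    a * w + w * ℓ       ≡⟨ solve 3 (λ a w ℓ → a :* w :+ w :* ℓ := w :* (ℓ :+ a)) refl a w ℓ ⟩
    w * (ℓ + a)         ≡⟨ cong (w *_) ℓ+a≡n+b ⟩
    w * (n + b)         ≡⟨ solve 3 (λ w n b → w :* (n :+ b) := b :* w :+ n :* w) refl w n b ⟩
    b * w + n * w       ≤⟨ +-monoˡ-≤ (n * w) (*-monoˡ-≤-0≤ 0≤b w≤X) ⟩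
    b * X + n * w       ≤⟨ bX+nw≤rhs ⟩
    b * X + n * w + a * Y ∎
    where open ≤-Reasoning

  pair-bound-chain : 0ℚ ≤ a → w ≤ Y → a * w + w * ℓ ≤ b * X + n * w + a * Y
  pair-bound-chain 0≤a w≤Y = begin
    a * w + w * ℓ       ≤⟨ +-mono-≤ (*-monoˡ-≤-0≤ 0≤a w≤Y) wℓ≤nw ⟩
    a * Y + n * w       ≤⟨ +-monoʳ-≤ (a * Y) nw≤bX+nw ⟩
    a * Y + (b * X + n * w) ≡⟨ +-comm (a * Y) _ ⟩
    b * X + n * w + a * Y ∎
    where open ≤-Reasoning

module LayeredEstimate
  {n : ℕ} (w : Fin n → Fin n → ℚ) (0≤w : ∀ i j → 0ℚ ≤ w i j) (w-sym : ∀ i j → w i j ≡ w j i)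
  {γ : ℚ} (1≤γ : 1ℚ ≤ γ) {VB : Subset n} (peel : PeelOff w γ (λ _ → true) VB)
  {Tstar : Tree n} (T*↭V : leaves Tstar ↭ allFin n)
  {δ : ℚ} (0<δ : 0ℚ < δ)
  {L R : Tree n} (N≤T* : SubTree (node L R) Tstar)
  (N-big : ℕ→ℚ n * (1ℚ - δ) < ℕ→ℚ (size (node L R)))
  (L-small : ℕ→ℚ (size L) ≤ ℕ→ℚ n * (1ℚ - δ))
  (R-small : ℕ→ℚ (size R) ≤ ℕ→ℚ n * (1ℚ - δ))
  {c : ℚ} (c-def : c * ℕ→ℚ n ≡ ℕ→ℚ (n ∸ size (node L R)))
  where

  N : Tree n
  N = node L R

  n̂ nδ nΔ W K : ℚ
  n̂ = ℕ→ℚ n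
  nδ = n̂ * δ
  nΔ = n̂ * (δ - c)
  W = totalW w
  K = γ * ℕ→ℚ 2 * W   -- n times the peel-off threshold

  unique-T* : Unique (leaves Tstar)
  unique-T* = Unique-resp-↭ (setoid (Fin n)) (↭⇒↭ₛ (↭-sym T*↭V)) (allFin⁺ n)

  unique-N : Unique (leaves N)
  unique-N = SubTree-Unique N≤T* unique-T*

  size-T* : size Tstar ≡ n
  size-T* = trans (↭-length T*↭V) (length-tabulate (λ i → i))

  cn+|N|≡n : c * n̂ + ℕ→ℚ (size N) ≡ n̂
  cn+|N|≡n = trans (cong (_+ ℕ→ℚ (size N)) c-def)
    (ℕ→ℚ-∸ (subst (size N ℕ.≤_) size-T* (SubTree-size-≤ N≤T*)))

  0≤nδ : 0ℚ ≤ nδ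
  0≤nδ = *-nonNeg (0≤ℕ→ℚ n) (<⇒≤ 0<δ)

  0≤nΔ : 0ℚ ≤ nΔ
  0≤nΔ = subst (0ℚ ≤_) nΔ-gap (0≤q-p (<⇒≤ N-big))
    where
    s = ℕ→ℚ (size N)
    nΔ-gap : s - n̂ * (1ℚ - δ) ≡ nΔ
    nΔ-gap = begin
      s - n̂ * (1ℚ - δ)
        ≡⟨ solve 4 (λ s n δ c → s :- n :* (con 1ℚ :- δ) := n :* (δ :- c) :+ (c :* n :+ s :- n)) refl s n̂ δ c ⟩
      nΔ + (c * n̂ + s - n̂)
        ≡⟨ cong (λ m → nΔ + (m - n̂)) cn+|N|≡n ⟩
      nΔ + (n̂ - n̂)
        ≡⟨ trans (cong (nΔ +_) (+-inverseʳ n̂)) (+-identityʳ nΔ) ⟩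
      nΔ ∎
      where open ≡-Reasoning

  inN : Fin n → Bool
  inN x = inT x L ∨ inT x R

  -- chainEdge i j is the blue weight of {i,j} charged to i when i lies outside N; its row sum
  -- at such an i is the final blue degree W_i.
  blueEdge crossEdge degreeTerm chainEdge X Y ℓ : Fin n → Fin n → ℚ
  blueEdge i j = if VB i ∧ VB j then w i j else 0ℚ
  crossEdge i j = if inT i L ∧ inT j R ∧ VB i ∧ VB j then w i j else 0ℚ
  degreeTerm i j = if VB j ∧ not (does (j ≟ i)) then w i j else 0ℚ
  chainEdge i j = if VB i ∧ not (inN i) then degreeTerm i j else 0ℚ
  X i j = crossEdge i j + crossEdge j i
  Y i j = chainEdge i j + chainEdge j i
  ℓ i j = ℕ→ℚ (lcaSize Tstar i j)

  data Position (x : Fin n) : Set where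
    inL     : x ∈ leaves L → Position x
    inR     : x ∈ leaves R → Position x
    outside : x ∉ leaves L → x ∉ leaves R → Position x

  open DecMem (_≟_ {n}) using (_∈?_)

  position : ∀ x → Position x
  position x with x ∈? leaves L | x ∈? leaves R
  ... | yes x∈L | _       = inL x∈L
  ... | no  _   | yes x∈R = inR x∈R
  ... | no  x∉L | no  x∉R = outside x∉L x∉R

  0≤crossEdge : ∀ i j → 0ℚ ≤ crossEdge i j
  0≤crossEdge i j = if-nonNeg (inT i L ∧ inT j R ∧ VB i ∧ VB j) (0≤w i j)

  0≤chainEdge : ∀ i j → 0ℚ ≤ chainEdge i j
  0≤chainEdge i j = if-nonNeg (VB i ∧ not (inN i)) (if-nonNeg (VB j ∧ not (does (j ≟ i))) (0≤w i j))

  ℓ≤n̂ : ∀ i j → ℓ i j ≤ n̂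
  ℓ≤n̂ i j = ℕ→ℚ-mono-≤ (subst (lcaSize Tstar i j ℕ.≤_) size-T* (lcaSize-≤-size Tstar i j))

  ℓ-nested : ∀ {t x y} → SubTree t N → ℕ→ℚ (size t) ≤ n̂ * (1ℚ - δ) →
    x ∈ leaves t → y ∈ leaves t → ℓ x y + nδ ≤ n̂
  ℓ-nested {t} {x} {y} t≤N t-small x∈t y∈t = begin
    ℓ x y + nδ                    ≡⟨ cong (λ m → ℕ→ℚ m + nδ) lca-in-t ⟩
    ℕ→ℚ (lcaSize t x y) + nδ      ≤⟨ +-monoˡ-≤ nδ (≤-trans (ℕ→ℚ-mono-≤ (lcaSize-≤-size t x y)) t-small) ⟩
    n̂ * (1ℚ - δ) + nδ             ≡⟨ solve 2 (λ n δ → n :* (con 1ℚ :- δ) :+ n :* δ := n) refl n̂ δ ⟩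
    n̂                             ∎
    where
    open ≤-Reasoning
    lca-in-t = lcaSize-SubTree (SubTree-trans t≤N N≤T*) unique-T* x∈t y∈t

  ℓ-split : ∀ {x y} → x ∈ leaves N → y ∈ leaves N → lcaSize N x y ≡ size N → ℓ x y + nδ ≡ n̂ + nΔ
  ℓ-split {x} {y} x∈N y∈N lca≡N = begin
    ℓ x y + nδ
      ≡⟨ cong (λ m → ℕ→ℚ m + nδ) (trans (lcaSize-SubTree N≤T* unique-T* x∈N y∈N) lca≡N) ⟩
    ℕ→ℚ (size N) + nδ
      ≡⟨ solve 4 (λ s n δ c → s :+ n :* δ := c :* n :+ s :+ n :* (δ :- c)) refl (ℕ→ℚ (size N)) n̂ δ c ⟩
    c * n̂ + ℕ→ℚ (size N) + nΔ
      ≡⟨ cong (_+ nΔ) cn+|N|≡n ⟩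
    n̂ + nΔ ∎
    where open ≡-Reasoning

  w≤X : ∀ {x y} → x ∈ leaves L → y ∈ leaves R → VB x ≡ true → VB y ≡ true → w x y ≤ X x y
  w≤X {x} {y} x∈L y∈R bx by = subst (_≤ X x y) crossEdge≡w (p≤p+q (crossEdge x y) (0≤crossEdge y x))
    where
    crossEdge≡w : crossEdge x y ≡ w x y
    crossEdge≡w = if-true (w x y) (∧-true (inT-∈ L x∈L) (∧-true (inT-∈ R y∈R) (∧-true bx by)))

  w≤Y : ∀ {x y} → x ∉ leaves L → x ∉ leaves R → VB x ≡ true → VB y ≡ true → y ≢ x → w x y ≤ Y x y
  w≤Y {x} {y} x∉L x∉R bx by y≢x = subst (_≤ Y x y) chainEdge≡w (p≤p+q (chainEdge x y) (0≤chainEdge y x))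
    where
    chainEdge≡w : chainEdge x y ≡ w x y
    chainEdge≡w = trans
      (if-true (degreeTerm x y) (∧-true bx (cong not (cong₂ _∨_ (inT-∉ L x∉L) (inT-∉ R x∉R)))))
      (if-true (w x y) (∧-true by (cong not (dec-false (y ≟ x) y≢x))))

  module PairBoundAt (i j : Fin n) = PairBound nδ nΔ n̂ (X i j) (Y i j) (w i j) (ℓ i j) (0≤w i j) (ℓ≤n̂ i j)
    (*-nonNeg 0≤nΔ (+-nonNeg (0≤crossEdge i j) (0≤crossEdge j i)))
    (*-nonNeg 0≤nδ (+-nonNeg (0≤chainEdge i j) (0≤chainEdge j i)))

  blue-pair-bound : ∀ i j → i ≢ j → VB i ≡ true → VB j ≡ true →
    nδ * w i j + w i j * ℓ i j ≤ nΔ * X i j + n̂ * w i j + nδ * Y i j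
  blue-pair-bound i j i≢j bi bj = by-position (position i) (position j)
    where
    open PairBoundAt i j
    by-position : Position i → Position j →
      nδ * w i j + w i j * ℓ i j ≤ nΔ * X i j + n̂ * w i j + nδ * Y i j
    by-position (inL i∈L) (inL j∈L) = pair-bound-nested (ℓ-nested (left here) L-small i∈L j∈L)
    by-position (inR i∈R) (inR j∈R) = pair-bound-nested (ℓ-nested (right here) R-small i∈R j∈R)
    by-position (inL i∈L) (inR j∈R) = pair-bound-split 0≤nΔ
      (ℓ-split (∈-++⁺ˡ i∈L) (∈-++⁺ʳ (leaves L) j∈R) (lcaSize-split {l = L} {R} unique-N i∈L j∈R))
      (w≤X i∈L j∈R bi bj)
    by-position (inR i∈R) (inL j∈L) = pair-bound-split 0≤nΔ
      (ℓ-split (∈-++⁺ʳ (leaves L) i∈R) (∈-++⁺ˡ j∈L) (lcaSize-split′ {l = L} {R} unique-N i∈R j∈L))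
      (subst₂ _≤_ (w-sym j i) (+-comm (crossEdge j i) (crossEdge i j)) (w≤X j∈L i∈R bj bi))
    by-position (outside i∉L i∉R) _ = pair-bound-chain 0≤nδ (w≤Y i∉L i∉R bi bj (i≢j ∘ sym))
    by-position _ (outside j∉L j∉R) = pair-bound-chain 0≤nδ
      (subst₂ _≤_ (w-sym j i) (+-comm (chainEdge j i) (chainEdge i j)) (w≤Y j∉L j∉R bj bi i≢j))

  pair-bound : ∀ i j → toℕ i ℕ.< toℕ j →
    nδ * blueEdge i j + w i j * ℓ i j ≤ nΔ * X i j + n̂ * w i j + nδ * Y i j
  pair-bound i j i<j = by-colour (VB i) (VB j) refl refl
    where
    by-colour : ∀ ci cj → VB i ≡ ci → VB j ≡ cj →
      nδ * (if ci ∧ cj then w i j else 0ℚ) + w i j * ℓ i j ≤ nΔ * X i j + n̂ * w i j + nδ * Y i j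
    by-colour true  true  bi bj = blue-pair-bound i j (λ i≡j → ℕ.<-irrefl (cong toℕ i≡j) i<j) bi bj
    by-colour true  false _  _  = PairBoundAt.pair-bound-unblue i j
    by-colour false _     _  _  = PairBoundAt.pair-bound-unblue i j

  M : ℚ
  M = sumFin (λ i → sumFin (chainEdge i))

  revenue-bound : nδ * weightIn w VB + Rev w Tstar ≤ nΔ * crossBlue w VB L R + n̂ * W + nδ * M
  revenue-bound = begin
    nδ * weightIn w VB + Rev w Tstar
      ≡⟨ cong (_+ Rev w Tstar) (sumPairs-*ˡ nδ blueEdge) ⟨
    sumPairs (λ i j → nδ * blueEdge i j) + sumPairs (λ i j → w i j * ℓ i j)
      ≡⟨ sumPairs-+ (λ i j → nδ * blueEdge i j) (λ i j → w i j * ℓ i j) ⟨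
    sumPairs (λ i j → nδ * blueEdge i j + w i j * ℓ i j)
      ≤⟨ sumPairs-mono-≤ pair-bound ⟩
    sumPairs (λ i j → nΔ * X i j + n̂ * w i j + nδ * Y i j)
      ≡⟨ trans (sumPairs-+ (λ i j → nΔ * X i j + n̂ * w i j) (λ i j → nδ * Y i j))
               (cong₂ _+_ (sumPairs-+ (λ i j → nΔ * X i j) (λ i j → n̂ * w i j)) refl) ⟩
    sumPairs (λ i j → nΔ * X i j) + sumPairs (λ i j → n̂ * w i j) + sumPairs (λ i j → nδ * Y i j)
      ≡⟨ cong₂ _+_ (cong₂ _+_ (sumPairs-*ˡ nΔ X) (sumPairs-*ˡ n̂ w)) (sumPairs-*ˡ nδ Y) ⟩
    nΔ * sumPairs X + n̂ * W + nδ * sumPairs Y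
      ≤⟨ +-mono-≤ (+-monoˡ-≤ (n̂ * W) (*-monoˡ-≤-0≤ 0≤nΔ (sumPairs-sym-≤ crossEdge 0≤crossEdge)))
                  (*-monoˡ-≤-0≤ 0≤nδ (sumPairs-sym-≤ chainEdge 0≤chainEdge)) ⟩
    nΔ * crossBlue w VB L R + n̂ * W + nδ * M ∎
    where open ≤-Reasoning

  0≤K : 0ℚ ≤ K
  0≤K = *-nonNeg (*-nonNeg (≤-trans (0≤ℕ→ℚ 1) 1≤γ) (0≤ℕ→ℚ 2))
                 (sumFin-nonNeg (λ i → sumFin-nonNeg (λ j → if-nonNeg _ (0≤w i j))))

  isChain : Fin n → ℚ
  isChain i = if not (inN i) then 1ℚ else 0ℚ

  chain-row-bound : ∀ i → n̂ * sumFin (chainEdge i) ≤ K * isChain i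
  chain-row-bound i = begin
    n̂ * sumFin (chainEdge i)
      ≡⟨ cong (n̂ *_) (sumFin-if (VB i ∧ not (inN i)) (degreeTerm i)) ⟩
    n̂ * (if VB i ∧ not (inN i) then degIn w VB i else 0ℚ)
      ≤⟨ by-colour (VB i) (inN i) refl ⟩
    K * isChain i ∎
    where
    open ≤-Reasoning
    by-colour : ∀ ci ni → VB i ≡ ci →
      n̂ * (if ci ∧ not ni then degIn w VB i else 0ℚ) ≤ K * (if not ni then 1ℚ else 0ℚ)
    by-colour true  false bi = subst₂ _≤_ (*-comm (degIn w VB i) n̂) (sym (*-identityʳ K))
                                 (<⇒≤ (PeelOff⇒degIn<threshold peel i bi))
    by-colour true  true  _  = ≤-reflexive (trans (*-zeroʳ n̂) (sym (*-zeroʳ K)))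
    by-colour false ni    _  = subst (_≤ K * _) (sym (*-zeroʳ n̂)) (*-nonNeg 0≤K (if-nonNeg (not ni) (0≤ℕ→ℚ 1)))

  isChain-count : sumFin isChain ≤ c * n̂
  isChain-count = +-cancelʳ-≤ (ℕ→ℚ (size N)) (begin
    sumFin isChain + ℕ→ℚ (size N)
      ≡⟨ cong (_+ ℕ→ℚ (size N)) (listSum-tabulate isChain (λ i → i)) ⟨
    listSum isChain (allFin n) + ℕ→ℚ (size N)
      ≡⟨ cong (_+ ℕ→ℚ (size N)) (listSum-↭ isChain (↭-sym T*↭V)) ⟩
    listSum isChain (leaves Tstar) + ℕ→ℚ (size N)
      ≤⟨ listSum-SubTree isChain≤1 N≤T* ⟩
    listSum isChain (leaves N) + ℕ→ℚ (size Tstar)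
      ≡⟨ cong₂ _+_ (listSum-zero (leaves N) isChain-N) (cong ℕ→ℚ size-T*) ⟩
    0ℚ + n̂
      ≡⟨ trans (+-identityˡ n̂) (sym cn+|N|≡n) ⟩
    c * n̂ + ℕ→ℚ (size N) ∎)
    where
    open ≤-Reasoning
    isChain≤1 : ∀ x → isChain x ≤ 1ℚ
    isChain≤1 x with not (inN x)
    ... | true  = ≤-refl
    ... | false = 0≤ℕ→ℚ 1
    isChain-N : ∀ {x} → x ∈ leaves N → isChain x ≡ 0ℚ
    isChain-N {x} x∈N with ∈-++⁻ (leaves L) x∈N
    ... | inj₁ x∈L = cong (λ b → if not (b ∨ inT x R) then 1ℚ else 0ℚ) (inT-∈ L x∈L)
    ... | inj₂ x∈R = cong (λ b → if not b then 1ℚ else 0ℚ)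
                          (trans (cong (inT x L ∨_) (inT-∈ R x∈R)) (∨-zeroʳ (inT x L)))

  chain-bound : n̂ * M ≤ K * (c * n̂)
  chain-bound = begin
    n̂ * M                                  ≡⟨ sumFin-*ˡ n̂ (λ i → sumFin (chainEdge i)) ⟨
    sumFin (λ i → n̂ * sumFin (chainEdge i))  ≤⟨ sumFin-mono-≤ chain-row-bound ⟩
    sumFin (λ i → K * isChain i)            ≡⟨ sumFin-*ˡ K isChain ⟩
    K * sumFin isChain                      ≤⟨ *-monoˡ-≤-0≤ 0≤K isChain-count ⟩
    K * (c * n̂)                            ∎
    where open ≤-Reasoning

  layered-bound : ∀ ε → Rev w Tstar ≡ (1ℚ - ε) * n̂ * W → 0ℚ < n̂ →
    δ * weightIn w VB - (ε + ℕ→ℚ 2 * c * δ * γ) * W ≤ crossBlue w VB L R * (δ - c)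
  layered-bound ε Rev≡ 0<n̂ = *-cancelʳ-≤-pos n̂ {{positive 0<n̂}} (begin
    (δ * WB - (ε + two * c * δ * γ) * W) * n̂
      ≡⟨ solve 8 (λ n δ WB ε W c γ two →
           (δ :* WB :- (ε :+ two :* c :* δ :* γ) :* W) :* n
             := n :* δ :* WB :+ (con 1ℚ :- ε) :* n :* W :- (n :* W :+ δ :* (γ :* two :* W :* (c :* n))))
           refl n̂ δ WB ε W c γ two ⟩
    nδ * WB + (1ℚ - ε) * n̂ * W - Z
      ≡⟨ cong (λ r → nδ * WB + r - Z) Rev≡ ⟨
    nδ * WB + Rev w Tstar - Z
      ≤⟨ +-monoˡ-≤ (- Z) revenue-bound ⟩
    nΔ * XLR + n̂ * W + nδ * M - Z
      ≡⟨ solve 7 (λ n δ c XLR W M K′ →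
           n :* (δ :- c) :* XLR :+ n :* W :+ n :* δ :* M :- (n :* W :+ δ :* K′)
             := n :* (δ :- c) :* XLR :+ δ :* (n :* M) :- δ :* K′)
           refl n̂ δ c XLR W M (K * (c * n̂)) ⟩
    nΔ * XLR + δ * (n̂ * M) - δ * (K * (c * n̂))
      ≤⟨ +-monoˡ-≤ (- (δ * (K * (c * n̂)))) (+-monoʳ-≤ (nΔ * XLR) (*-monoˡ-≤-0≤ (<⇒≤ 0<δ) chain-bound)) ⟩
    nΔ * XLR + δ * (K * (c * n̂)) - δ * (K * (c * n̂))
      ≡⟨ solve 5 (λ n δ c XLR D → n :* (δ :- c) :* XLR :+ D :- D := XLR :* (δ :- c) :* n)
           refl n̂ δ c XLR (δ * (K * (c * n̂))) ⟩
    XLR * (δ - c) * n̂ ∎)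
    where
    open ≤-Reasoning
    WB XLR two Z : ℚ
    WB = weightIn w VB
    XLR = crossBlue w VB L R
    two = ℕ→ℚ 2
    Z = n̂ * W + δ * (K * (c * n̂))

lemma5 : (n : ℕ) (w : Fin n → Fin n → ℚ) →
    (∀ i j → 0ℚ ≤ w i j) → (∀ i j → w i j ≡ w j i) →
    (γ : ℚ) → 1ℚ ≤ γ →
    (VB : Subset n) → PeelOff w γ (λ _ → true) VB →
    (Tstar : Tree n) → leaves Tstar ↭ allFin n →
    (∀ (T : Tree n) → leaves T ↭ allFin n → Rev w T ≤ Rev w Tstar) →
    (ε : ℚ) → Rev w Tstar ≡ (1ℚ - ε) * ℕ→ℚ n * totalW w →
    (δ : ℚ) → 0ℚ < δ → δ * ℕ→ℚ 2 < 1ℚ →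
    (L R : Tree n) → SubTree (node L R) Tstar →
    ℕ→ℚ n * (1ℚ - δ) < ℕ→ℚ (size (node L R)) →
    ℕ→ℚ (size L) ≤ ℕ→ℚ n * (1ℚ - δ) →
    ℕ→ℚ (size R) ≤ ℕ→ℚ n * (1ℚ - δ) →
    (c : ℚ) → c * ℕ→ℚ n ≡ ℕ→ℚ (n ∸ size (node L R)) →
    δ * weightIn w VB - (ε + ℕ→ℚ 2 * c * δ * γ) * totalW w
    ≤ crossBlue w VB L R * (δ - c)
lemma5 zero _ _ _ γ _ _ _ _ _ _ ε _ δ _ _ _ _ _ _ _ _ c _ =
  ≤-reflexive (solve 3 (λ δ e c → δ :* con 0ℚ :- e :* con 0ℚ := con 0ℚ :* (δ :- c))
                       refl δ (ε + ℕ→ℚ 2 * c * δ * γ) c)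
lemma5 (suc m) w 0≤w w-sym γ 1≤γ VB peel Tstar T*↭V _ ε Rev≡ δ 0<δ _ L R N≤T* N-big L-small R-small c c-def =
  LayeredEstimate.layered-bound w 0≤w w-sym 1≤γ peel T*↭V 0<δ N≤T* N-big L-small R-small c-def ε
    Rev≡ (positive⁻¹ (ℕ→ℚ (suc m)) {{normalize-pos (suc m) 1}})
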